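{- Let $n,r\in\mathbb{N}$ and let $p$ be an odd prime. Then for any partition of $\mathbb{N}$ into $r$ cells there exist $x,z,c\in\mathbb{N}$ such that the set \[ \left\{ xz\left(p^{i}+1\right)^{c}-x:i\in\left\{ 1,2,\ldots,n\right\} \right\} \] is contained in a single cell.
   Context: $\mathbb{N}$ denotes the set of positive integers. -}

module Defs where

open import Data.Nat using (ℕ; suc; _+_; _*_; _∸_; _^_)

-- The element x z (p^i + 1)^c - x of the set in the theorem.
-- (Truncated subtraction is harmless: for z, c ≥ 1 the value is ≥ x.)
elem : ℕ → ℕ → ℕ → ℕ → ℕ → ℕ
elem p x z c i = x * z * (p ^ i + 1) ^ c ∸ x

-- Colour every exponent vector v ∈ ℕⁿ by the colour of ∏ᵢ (pⁱ⁺¹ + 1)^{vᵢ} − 1.  The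
-- Hales–Jewett theorem, read on letter counts, gives w ∈ ℕⁿ and c ≥ 1 such that the n
-- points w + c·eᵢ have the same colour; with x = 1, z = ∏ᵢ (pⁱ⁺¹ + 1)^{wᵢ} these points
-- are exactly the numbers x z (pⁱ + 1)^c − x.  The counting form of Hales–Jewett is
-- proved by colour focusing: a fan of lines that are monochromatic off a common focus,
-- in pairwise distinct colours also distinct from that of the focus, can be extended by
-- one more line (using Hales–Jewett in one dimension less to shift the whole fan), and
-- with r colours there cannot be r such lines.
module Submission where

open import Defs
open import Data.Nat using (ℕ; NonZero; _≤_)
open import Data.Nat.Primality using (Prime)
open import Data.Fin using (Fin)
open import Data.Product using (Σ; _×_)
open import Relation.Binary.PropositionalEquality using (_≡_; _≢_)

open import Data.Nat using (zero; suc; _+_; _*_; _^_; _∸_; s≤s; >-nonZero)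
open import Data.Nat.Properties
open import Data.Nat.Tactic.RingSolver using (solve-∀)
open import Data.Fin using (zero; suc; toℕ; fromℕ<; funToFin; finToFun)
open import Data.Fin.Properties using (finToFun-funToFin; any?; <⇒notInjective; toℕ-fromℕ<)
  renaming (_≟_ to _≟ᶠ_)
open import Data.Vec using (Vec; []; _∷_; zipWith; sum; replicate; _[_]%=_)
import Data.Vec.Functional as Fun
open import Data.List as List using (List; upTo; cartesianProductWith; length)
open import Data.List.Membership.Propositional using (_∈_)
open import Data.List.Membership.Propositional.Properties using (∈-upTo⁺; ∈-cartesianProductWith⁺)
open import Data.List.Relation.Unary.Any as Any using (here)
open import Data.List.Relation.Unary.Any.Properties using (lookup-index)
open import Data.Product using (∃-syntax; _,_; proj₁; proj₂)
open import Data.Sum using (_⊎_; inj₁; inj₂; [_,_]′)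
open import Data.Empty using (⊥-elim)
open import Function using (_∘_; id)
open import Function.Definitions using (Injective)
open import Relation.Binary.PropositionalEquality using (refl; sym; trans; cong; cong₂; module ≡-Reasoning)
open import Relation.Nullary using (yes; no)

open ≡-Reasoning

+-interchange : ∀ a b c d → (a + b) + (c + d) ≡ (a + c) + (b + d)
+-interchange = solve-∀

+-right-comm : ∀ a b c → (a + b) + c ≡ (a + c) + b
+-right-comm = solve-∀

*-right-comm : ∀ a b c → (a * b) * c ≡ (a * c) * b
*-right-comm = solve-∀

infixl 6 _⊕_ _+[_]_

_⊕_ : ∀ {m} → Vec ℕ m → Vec ℕ m → Vec ℕ m
_⊕_ = zipWith _+_

_+[_]_ : ∀ {m} → Vec ℕ m → Fin m → ℕ → Vec ℕ m
w +[ i ] c = w [ i ]%= (_+ c)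

sum-replicate-zero : ∀ m → sum (replicate m 0) ≡ 0
sum-replicate-zero zero    = refl
sum-replicate-zero (suc m) = sum-replicate-zero m

sum-⊕ : ∀ {m} (a b : Vec ℕ m) → sum (a ⊕ b) ≡ sum a + sum b
sum-⊕ []      []      = refl
sum-⊕ (x ∷ a) (y ∷ b) = trans (cong (x + y +_) (sum-⊕ a b)) (+-interchange x y (sum a) (sum b))

sum-+[] : ∀ {m} (w : Vec ℕ m) i c → sum (w +[ i ] c) ≡ sum w + c
sum-+[] (x ∷ w) zero    c = +-right-comm x c (sum w)
sum-+[] (x ∷ w) (suc i) c = trans (cong (x +_) (sum-+[] w i c)) (sym (+-assoc x (sum w) c))

⊕-+[] : ∀ {m} (a b : Vec ℕ m) i c d → a ⊕ b +[ i ] (c + d) ≡ (a +[ i ] c) ⊕ (b +[ i ] d)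
⊕-+[] (x ∷ a) (y ∷ b) zero    c d = cong (_∷ a ⊕ b) (+-interchange x y c d)
⊕-+[] (x ∷ a) (y ∷ b) (suc i) c d = cong (x + y ∷_) (⊕-+[] a b i c d)

⊕-+[]ˡ : ∀ {m} (a b : Vec ℕ m) i c → a ⊕ b +[ i ] c ≡ (a +[ i ] c) ⊕ b
⊕-+[]ˡ (x ∷ a) (y ∷ b) zero    c = cong (_∷ a ⊕ b) (+-right-comm x y c)
⊕-+[]ˡ (x ∷ a) (y ∷ b) (suc i) c = cong (x + y ∷_) (⊕-+[]ˡ a b i c)

⊕-+[]ʳ : ∀ {m} (a b : Vec ℕ m) i c → a ⊕ b +[ i ] c ≡ a ⊕ (b +[ i ] c)
⊕-+[]ʳ (x ∷ a) (y ∷ b) zero    c = cong (_∷ a ⊕ b) (+-assoc x y c)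
⊕-+[]ʳ (x ∷ a) (y ∷ b) (suc i) c = cong (x + y ∷_) (⊕-+[]ʳ a b i c)

box : ℕ → (m : ℕ) → List (Vec ℕ m)
box B zero    = List.[ [] ]
box B (suc m) = cartesianProductWith _∷_ (upTo (suc B)) (box B m)

∈-box : ∀ B {m} (a : Vec ℕ m) → sum a ≤ B → a ∈ box B m
∈-box B []      _      = here refl
∈-box B (x ∷ a) x+a≤B  = ∈-cartesianProductWith⁺ _∷_
  (∈-upTo⁺ (s≤s (≤-trans (m≤m+n x (sum a)) x+a≤B)))
  (∈-box B a (≤-trans (m≤n+m (sum a) x) x+a≤B))

pack : ∀ {A : Set} {r} (xs : List A) → (A → Fin r) → Fin (r ^ length xs)
pack xs g = funToFin (g ∘ List.lookup xs)

pack-injective : ∀ {A : Set} {r} (xs : List A) (g h : A → Fin r) →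
                 pack xs g ≡ pack xs h → ∀ {a} → a ∈ xs → g a ≡ h a
pack-injective xs g h g≡h {a} a∈xs = begin
  g a                                ≡⟨ cong g (lookup-index a∈xs) ⟩
  g (List.lookup xs j)               ≡⟨ finToFun-funToFin (g ∘ List.lookup xs) j ⟨
  finToFun (pack xs g) j             ≡⟨ cong (λ k → finToFun k j) g≡h ⟩
  finToFun (pack xs h) j             ≡⟨ finToFun-funToFin (h ∘ List.lookup xs) j ⟩
  h (List.lookup xs j)               ≡⟨ cong h (lookup-index a∈xs) ⟨
  h a                                ∎
  where j = Any.index a∈xs

record MonochromaticLine {m r} (χ : Vec ℕ m → Fin r) (N : ℕ) : Set where
  constructor line
  field
    base          : Vec ℕ m
    step          : ℕ
    step≥1        : 1 ≤ step
    size          : sum base + step ≡ N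
    colour        : Fin r
    monochromatic : ∀ i → χ (base +[ i ] step) ≡ colour

-- The letter-count image of a combinatorial line of words of length N over an alphabet of size m.
HalesJewett : ℕ → Set
HalesJewett m = ∀ r → ∃[ N ] ∀ (χ : Vec ℕ m → Fin r) → MonochromaticLine χ N

halesJewett₀ : HalesJewett 0
halesJewett₀ r = 1 , λ χ → line [] 1 ≤-refl refl (χ []) λ ()

halesJewett₁ : HalesJewett 1
halesJewett₁ r = 1 , λ χ → line (0 ∷ []) 1 ≤-refl refl (χ (1 ∷ [])) λ { zero → refl }

record UniformShift {k r} (χ : Vec ℕ (suc k) → Fin r) (N M : ℕ) : Set where
  field
    offset  : Vec ℕ k
    stride  : ℕ
    stride≥1 : 1 ≤ stride
    size    : sum offset + stride ≡ M
    uniform : ∀ a → sum a ≡ N → ∀ i j →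
              χ (a ⊕ (0 ∷ offset +[ i ] stride)) ≡ χ (a ⊕ (0 ∷ offset +[ j ] stride))

-- Colour v ∈ ℕᵏ by the whole colouring a ↦ χ (a ⊕ (0 ∷ v)) of the points of size N.
uniformShift : ∀ {k} → HalesJewett k → ∀ r N → ∃[ M ] ∀ (χ : Vec ℕ (suc k) → Fin r) → UniformShift χ N M
uniformShift {k} hj r N = proj₁ (hj (r ^ length points)) , shift
  where
  points = box N (suc k)

  shift : ∀ χ → UniformShift χ N _
  shift χ = record
    { offset = base ; stride = step ; stride≥1 = step≥1 ; size = size
    ; uniform = λ a a≡N i j → pack-injective points _ _
        (trans (monochromatic i) (sym (monochromatic j))) (∈-box N a (≤-reflexive a≡N)) }
    where
    open MonochromaticLine (proj₂ (hj (r ^ length points)) (λ v → pack points (λ a → χ (a ⊕ (0 ∷ v)))))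

record Fan {m r} (χ : Vec ℕ (suc m) → Fin r) (N s : ℕ) : Set where
  field
    focus         : Vec ℕ (suc m)
    focus-size    : sum focus ≡ N
    base          : Fin s → Vec ℕ (suc m)
    step          : Fin s → ℕ
    step≥1        : ∀ j → 1 ≤ step j
    focused       : ∀ j → base j +[ zero ] step j ≡ focus
    colour        : Fin s → Fin r
    monochromatic : ∀ j i → χ (base j +[ suc i ] step j) ≡ colour j

  line-size : ∀ j → sum (base j) + step j ≡ N
  line-size j = begin
    sum (base j) + step j            ≡⟨ sum-+[] (base j) zero (step j) ⟨
    sum (base j +[ zero ] step j)    ≡⟨ cong sum (focused j) ⟩
    sum focus                        ≡⟨ focus-size ⟩
    N                                ∎

  point-size : ∀ j i → sum (base j +[ i ] step j) ≡ N
  point-size j i = trans (sum-+[] (base j) i (step j)) (line-size j)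

  lineAt : ∀ j → χ focus ≡ colour j → MonochromaticLine χ N
  lineAt j focus≡j = line (base j) (step j) (step≥1 j) (line-size j) (colour j) λ
    { zero    → trans (cong χ (focused j)) focus≡j
    ; (suc i) → monochromatic j i }

Focused : ∀ {m r} {χ : Vec ℕ (suc m) → Fin r} {N s} → Fan χ N s → Set
Focused {χ = χ} φ = Injective _≡_ _≡_ (χ (Fan.focus φ) Fun.∷ Fan.colour φ)

FocusedFan : ∀ {m r} → (Vec ℕ (suc m) → Fin r) → ℕ → ℕ → Set
FocusedFan χ N s = Σ (Fan χ N s) Focused

lineOrFocused : ∀ {m r} {χ : Vec ℕ (suc m) → Fin r} {N s} (φ : Fan χ N s) →
                Injective _≡_ _≡_ (Fan.colour φ) → MonochromaticLine χ N ⊎ Focused φ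
lineOrFocused {χ = χ} φ distinct with any? (λ j → χ focus ≟ᶠ colour j)
  where open Fan φ
... | yes (j , focus≡j) = inj₁ (Fan.lineAt φ j focus≡j)
... | no focus≢colours  = inj₂ injective
  where
  injective : Focused φ
  injective {zero}  {zero}  _ = refl
  injective {zero}  {suc j} e = ⊥-elim (focus≢colours (j , e))
  injective {suc i} {zero}  e = ⊥-elim (focus≢colours (i , sym e))
  injective {suc i} {suc j} e = cong suc (distinct e)

emptyFan : ∀ {m r} (χ : Vec ℕ (suc m) → Fin r) → FocusedFan χ 0 0
emptyFan {m} χ = fan , λ { {zero} {zero} _ → refl }
  where
  fan : Fan χ 0 0
  fan = record
    { focus = replicate (suc m) 0 ; focus-size = sum-replicate-zero (suc m)
    ; base = λ () ; step = λ () ; step≥1 = λ () ; focused = λ () ; colour = λ () ; monochromatic = λ () }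

module Shifted {k r} {χ : Vec ℕ (suc (suc k)) → Fin r} {N M} (σ : UniformShift χ N M) where
  open UniformShift σ

  U : Vec ℕ (suc (suc k))
  U = 0 ∷ offset

  ψ : Vec ℕ (suc (suc k)) → Fin r
  ψ a = χ (a ⊕ (U +[ suc zero ] stride))

  absorb : ∀ a → sum a ≡ N → ∀ i → χ (a ⊕ (U +[ suc i ] stride)) ≡ ψ a
  absorb a a≡N i = uniform a a≡N i zero

  liftLine : MonochromaticLine ψ N → MonochromaticLine χ (N + M)
  liftLine (line w c c≥1 w+c≡N K mono) =
    line (w ⊕ V) c c≥1 size′ K λ i → trans (cong χ (⊕-+[]ˡ w V i c)) (mono i)
    where
    V = U +[ suc zero ] stride
    size′ : sum (w ⊕ V) + c ≡ N + M
    size′ = begin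
      sum (w ⊕ V) + c             ≡⟨ cong (_+ c) (sum-⊕ w V) ⟩
      sum w + sum V + c           ≡⟨ +-right-comm (sum w) (sum V) c ⟩
      sum w + c + sum V           ≡⟨ cong (sum w + c +_) (trans (sum-+[] U (suc zero) stride) size) ⟩
      sum w + c + M               ≡⟨ cong (_+ M) w+c≡N ⟩
      N + M                       ∎

  liftFan : ∀ {s} (φ : Fan ψ N s) → Fan χ (N + M) (suc s)
  liftFan {s} φ = record
    { focus = F ; focus-size = F-size ; base = base′ ; step = step′ ; step≥1 = step′≥1
    ; focused = focused′ ; colour = ψ focus Fun.∷ colour ; monochromatic = monochromatic′ }
    where
    open Fan φ
    F = focus ⊕ U +[ zero ] stride

    F-size : sum F ≡ N + M
    F-size = begin
      sum F                       ≡⟨ sum-+[] (focus ⊕ U) zero stride ⟩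
      sum (focus ⊕ U) + stride    ≡⟨ cong (_+ stride) (sum-⊕ focus U) ⟩
      sum focus + sum U + stride  ≡⟨ +-assoc (sum focus) (sum U) stride ⟩
      sum focus + (sum U + stride) ≡⟨ cong₂ _+_ focus-size size ⟩
      N + M                       ∎

    base′ : Fin (suc s) → Vec ℕ (suc (suc k))
    base′ zero    = focus ⊕ U
    base′ (suc j) = base j ⊕ U

    step′ : Fin (suc s) → ℕ
    step′ zero    = stride
    step′ (suc j) = step j + stride

    step′≥1 : ∀ t → 1 ≤ step′ t
    step′≥1 zero    = stride≥1
    step′≥1 (suc j) = ≤-trans (step≥1 j) (m≤m+n (step j) stride)

    focused′ : ∀ t → base′ t +[ zero ] step′ t ≡ F
    focused′ zero    = refl
    focused′ (suc j) = begin
      base j ⊕ U +[ zero ] (step j + stride)          ≡⟨ ⊕-+[] (base j) U zero (step j) stride ⟩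
      (base j +[ zero ] step j) ⊕ (U +[ zero ] stride) ≡⟨ cong (_⊕ (U +[ zero ] stride)) (focused j) ⟩
      focus ⊕ (U +[ zero ] stride)                    ≡⟨ ⊕-+[]ʳ focus U zero stride ⟨
      F                                               ∎

    monochromatic′ : ∀ t i → χ (base′ t +[ suc i ] step′ t) ≡ (ψ focus Fun.∷ colour) t
    monochromatic′ zero i = begin
      χ (focus ⊕ U +[ suc i ] stride)       ≡⟨ cong χ (⊕-+[]ʳ focus U (suc i) stride) ⟩
      χ (focus ⊕ (U +[ suc i ] stride))     ≡⟨ absorb focus focus-size i ⟩
      ψ focus                               ∎
    monochromatic′ (suc j) i = begin
      χ (base j ⊕ U +[ suc i ] (step j + stride))                 ≡⟨ cong χ (⊕-+[] (base j) U (suc i) (step j) stride) ⟩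
      χ ((base j +[ suc i ] step j) ⊕ (U +[ suc i ] stride))      ≡⟨ absorb _ (point-size j (suc i)) i ⟩
      ψ (base j +[ suc i ] step j)                                ≡⟨ monochromatic j i ⟩
      colour j                                                    ∎

focusing : ∀ {k} → HalesJewett (suc k) → ∀ r s →
           ∃[ N ] ∀ (χ : Vec ℕ (suc (suc k)) → Fin r) → MonochromaticLine χ N ⊎ FocusedFan χ N s
focusing hj r zero    = 0 , inj₂ ∘ emptyFan
focusing hj r (suc s) with focusing hj r s
... | N , lineOrFanₛ with uniformShift hj r N
... | M , shift = N + M , λ χ → extend χ (lineOrFanₛ (Shifted.ψ (shift χ)))
  where
  extend : ∀ χ → MonochromaticLine (Shifted.ψ (shift χ)) N ⊎ FocusedFan (Shifted.ψ (shift χ)) N s →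
           MonochromaticLine χ (N + M) ⊎ FocusedFan χ (N + M) (suc s)
  extend χ (inj₁ ℓ) = inj₁ (Shifted.liftLine (shift χ) ℓ)
  extend χ (inj₂ (φ , focusedφ)) with lineOrFocused (Shifted.liftFan (shift χ) φ) focusedφ
  ... | inj₁ ℓ        = inj₁ ℓ
  ... | inj₂ focused′ = inj₂ (Shifted.liftFan (shift χ) φ , focused′)

halesJewett-step : ∀ {k} → HalesJewett (suc k) → HalesJewett (suc (suc k))
halesJewett-step hj r with focusing hj r r
... | N , lineOrFan = N , λ χ →
  [ id , (λ (_ , focused) → ⊥-elim (<⇒notInjective (n<1+n r) focused)) ]′ (lineOrFan χ)

halesJewett : ∀ m → HalesJewett m
halesJewett zero          = halesJewett₀
halesJewett (suc zero)    = halesJewett₁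
halesJewett (suc (suc k)) = halesJewett-step (halesJewett (suc k))

monomial : ∀ {m} → (Fin m → ℕ) → Vec ℕ m → ℕ
monomial b []      = 1
monomial b (x ∷ v) = b zero ^ x * monomial (b ∘ suc) v

monomial-+[] : ∀ {m} (b : Fin m → ℕ) v i c → monomial b (v +[ i ] c) ≡ monomial b v * b i ^ c
monomial-+[] b (x ∷ v) zero    c = begin
  b zero ^ (x + c) * monomial (b ∘ suc) v              ≡⟨ cong (_* monomial (b ∘ suc) v) (^-distribˡ-+-* (b zero) x c) ⟩
  b zero ^ x * b zero ^ c * monomial (b ∘ suc) v       ≡⟨ *-right-comm (b zero ^ x) (b zero ^ c) _ ⟩
  b zero ^ x * monomial (b ∘ suc) v * b zero ^ c       ∎
monomial-+[] b (x ∷ v) (suc i) c =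
  trans (cong (b zero ^ x *_) (monomial-+[] (b ∘ suc) v i c)) (sym (*-assoc (b zero ^ x) _ _))

monomial-nonZero : ∀ {m} (b : Fin m → ℕ) → (∀ i → NonZero (b i)) → ∀ v → NonZero (monomial b v)
monomial-nonZero b b≢0 []      = _
monomial-nonZero b b≢0 (x ∷ v) =
  m*n≢0 _ _ {{m^n≢0 (b zero) x {{b≢0 zero}}}} {{monomial-nonZero (b ∘ suc) (b≢0 ∘ suc) v}}

mainTheorem9 : (n r p : ℕ) → NonZero n → NonZero r → Prime p → p ≢ 2 →
    (χ : ℕ → Fin r) →
    Σ ℕ λ x → Σ ℕ λ z → Σ ℕ λ c → NonZero x × NonZero z × NonZero c ×
    Σ (Fin r) λ k → (i : ℕ) → 1 ≤ i → i ≤ n → χ (elem p x z c i) ≡ k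
mainTheorem9 n r p _ _ _ _ χ =
  1 , monomial b base , step , _ , monomial-nonZero b b≢0 base , >-nonZero step≥1 , colour , onSet
  where
  b : Fin n → ℕ
  b t = p ^ suc (toℕ t) + 1

  b≢0 : ∀ t → NonZero (b t)
  b≢0 t = >-nonZero (m≤n+m 1 (p ^ suc (toℕ t)))

  open MonochromaticLine (proj₂ (halesJewett n r) (λ v → χ (monomial b v ∸ 1)))

  onSet : (i : ℕ) → 1 ≤ i → i ≤ n → χ (elem p 1 (monomial b base) step i) ≡ colour
  onSet (suc i) _ i<n = trans (cong (λ z → χ (z ∸ 1)) point) (monochromatic j)
    where
    j = fromℕ< i<n
    point : 1 * monomial b base * (p ^ suc i + 1) ^ step ≡ monomial b (base +[ j ] step)
    point = begin
      1 * monomial b base * (p ^ suc i + 1) ^ step   ≡⟨ cong (_* (p ^ suc i + 1) ^ step) (*-identityˡ (monomial b base)) ⟩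
      monomial b base * (p ^ suc i + 1) ^ step       ≡⟨ cong (λ t → monomial b base * (p ^ suc t + 1) ^ step) (toℕ-fromℕ< i<n) ⟨
      monomial b base * b j ^ step                   ≡⟨ monomial-+[] b base j step ⟨
      monomial b (base +[ j ] step)                  ∎
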